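{- Let $c,m,n$ be positive integers with $m\le n$ and let $L_{c,m,n}:=\operatorname{lcm}\{m^2+c,(m+1)^2+c,\dots,n^2+c\}$. Then $L_{c,m,n}\,(n-m)!$ is a multiple in $\mathbb{Z}$ of the positive integer $$\frac{\prod_{k=m}^{n}(k^2+c)}{h_c\left(\prod_{k=m}^{n}(k+\sqrt{ -c})\right)}.$$
   Context: $\sqrt{ -c}:=i\sqrt c$, and $h_c:\mathbb{Z}[\sqrt{ -c}]\setminus\{0\}\to\mathbb{N}^*$ is defined by $h_c(a+b\sqrt{ -c}):=\gcd(a,b)$ for $a,b\in\mathbb{Z}$ not both zero. -}

module Defs where

open import Data.Nat using (ℕ; zero; suc; _+_; _*_; _∸_)
open import Data.Nat.GCD using (gcd)
open import Data.Nat.LCM using (lcm)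
open import Data.Integer as ℤ using (ℤ; +_; ∣_∣)
open import Data.List using (List; map; upTo; foldr)
open import Data.Product using (_×_; _,_; proj₁; proj₂)

-- An element a + b√-c of ℤ[√-c] is represented by the pair (a , b) of integers.
ℤ√- : Set
ℤ√- = ℤ × ℤ

-- Multiplication in ℤ[√-c]: (a + b√-c)(a' + b'√-c) = (aa' - c bb') + (ab' + a'b)√-c
mulC : ℕ → ℤ√- → ℤ√- → ℤ√-
mulC c (a , b) (a' , b') =
  (a ℤ.* a' ℤ.- (+ c) ℤ.* (b ℤ.* b')) , (a ℤ.* b' ℤ.+ a' ℤ.* b)

oneC : ℤ√-
oneC = (+ 1 , + 0)

hC : ℤ√- → ℕ
hC (a , b) = gcd ∣ a ∣ ∣ b ∣

range : ℕ → ℕ → List ℕ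
range m n = map (λ i → m + i) (upTo (suc (n ∸ m)))

prodRoot : ℕ → ℕ → ℕ → ℤ√-
prodRoot c m n = foldr (λ k acc → mulC c (+ k , + 1) acc) oneC (range m n)

prodNorm : ℕ → ℕ → ℕ → ℕ
prodNorm c m n = foldr (λ k acc → (k * k + c) * acc) 1 (range m n)

Lcmn : ℕ → ℕ → ℕ → ℕ
Lcmn c m n = foldr (λ k acc → lcm (k * k + c) acc) 1 (range m n)

-- Let P = ∏ₖ (k + √-c) = A + B√-c; its norm A² + cB² is ∏ₖ (k² + c).
-- If M is a multiple of every k² + c with x ≤ k ≤ x + N, then M·N! is a multiple w P of P in
-- ℤ[√-c], by induction on N: splitting off the last or the first factor, P = P′ (x + N + √-c)
-- = (x + √-c) P″, and the induction hypothesis gives w′ P′ = w″ P″ = M·(N−1)!, so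
-- (w′ − w″) P = M·(N−1)! ((x + N + √-c) − (x + √-c)) = M·N!.
-- Multiplying w P = T by the conjugate of P gives T A = u N(P) and T B = −v N(P), so
-- N(P) ∣ T·gcd(A, B); since gcd(A, B) = h(P) divides N(P), the quotient N(P)/h(P) divides T.
module Submission where

open import Defs
open import Data.Nat using (ℕ; _*_; _∸_; _≤_; NonZero; _!)
open import Data.Nat.Divisibility using (_∣_)
open import Data.Product using (Σ; _×_)
open import Relation.Binary.PropositionalEquality using (_≡_)

open import Data.Nat as ℕ using (zero; suc; _+_)
import Data.Nat.Properties as ℕₚ
import Data.Nat.Divisibility as ℕ∣
open import Data.Nat.DivMod using (_/_; m/n*n≡m)
open import Data.Nat.GCD using (gcd-greatest; c*gcd[m,n]≡gcd[cm,cn]; gcd[m,n]∣m; gcd[m,n]∣n)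
open import Data.Nat.LCM using (lcm; m∣lcm[m,n]; n∣lcm[m,n])
open import Data.Integer as ℤ using (ℤ; +_; ∣_∣; -_)
import Data.Integer.Properties as ℤₚ
import Data.Integer.Divisibility.Signed as ℤ∣
open import Data.Integer.Tactic.RingSolver using (solve-∀)
open import Data.List using (List; []; _∷_; _∷ʳ_; foldr; applyUpTo)
open import Data.List.Properties using (map-upTo)
open import Data.List.Relation.Unary.All as All using (All; []; _∷_)
open import Data.List.Relation.Unary.All.Properties using (∷ʳ⁻)
open import Data.Product using (_,_; proj₁; proj₂)
open import Relation.Binary.PropositionalEquality
  using (refl; sym; trans; cong; cong₂; subst; subst₂; module ≡-Reasoning)
open import Function using (_∘_)

interval : ℕ → ℕ → List ℕ
interval x zero    = x ∷ []
interval x (suc N) = x ∷ interval (suc x) N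

interval-∷ʳ : ∀ x N → interval x (suc N) ≡ interval x N ∷ʳ (x + suc N)
interval-∷ʳ x zero    = cong (λ y → x ∷ y ∷ []) (ℕₚ.+-comm 1 x)
interval-∷ʳ x (suc N) = cong (x ∷_)
  (trans (interval-∷ʳ (suc x) N) (cong (interval (suc x) N ∷ʳ_) (sym (ℕₚ.+-suc x (suc N)))))

applyUpTo≡interval : ∀ f x N → (∀ i → f i ≡ x + i) → applyUpTo f (suc N) ≡ interval x N
applyUpTo≡interval f x zero    f≡ = cong (_∷ []) (trans (f≡ 0) (ℕₚ.+-identityʳ x))
applyUpTo≡interval f x (suc N) f≡ = cong₂ _∷_ (trans (f≡ 0) (ℕₚ.+-identityʳ x))
  (applyUpTo≡interval (f ∘ suc) (suc x) N λ i → trans (f≡ (suc i)) (ℕₚ.+-suc x i))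

range≡interval : ∀ m n → range m n ≡ interval m (n ∸ m)
range≡interval m n = trans (map-upTo (λ i → m + i) (suc (n ∸ m)))
  (applyUpTo≡interval (λ i → m + i) m (n ∸ m) λ _ → refl)

module _ (c : ℕ) where

  subC : ℤ√- → ℤ√- → ℤ√-
  subC (a , b) (a' , b') = (a ℤ.- a') , (b ℤ.- b')

  normC : ℤ√- → ℤ
  normC (a , b) = a ℤ.* a ℤ.+ + c ℤ.* (b ℤ.* b)

  -- The ring-solver identities quantify over k, standing for + c: the solver cannot
  -- normalise the constant + c itself.

  mulC-comm : ∀ x y → mulC c x y ≡ mulC c y x
  mulC-comm (a , b) (a' , b') = cong₂ _,_ (re (+ c) a b a' b') (im a b a' b')
    where
    re : ∀ (k a b a' b' : ℤ) → a ℤ.* a' ℤ.- k ℤ.* (b ℤ.* b') ≡ a' ℤ.* a ℤ.- k ℤ.* (b' ℤ.* b)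
    re = solve-∀
    im : ∀ (a b a' b' : ℤ) → a ℤ.* b' ℤ.+ a' ℤ.* b ≡ a' ℤ.* b ℤ.+ a ℤ.* b'
    im = solve-∀

  mulC-assoc : ∀ x y z → mulC c (mulC c x y) z ≡ mulC c x (mulC c y z)
  mulC-assoc (a , b) (a' , b') (a'' , b'') =
    cong₂ _,_ (re (+ c) a b a' b' a'' b'') (im (+ c) a b a' b' a'' b'')
    where
    re : ∀ (k a b a' b' a'' b'' : ℤ) →
      (a ℤ.* a' ℤ.- k ℤ.* (b ℤ.* b')) ℤ.* a'' ℤ.- k ℤ.* ((a ℤ.* b' ℤ.+ a' ℤ.* b) ℤ.* b'')
        ≡ a ℤ.* (a' ℤ.* a'' ℤ.- k ℤ.* (b' ℤ.* b'')) ℤ.- k ℤ.* (b ℤ.* (a' ℤ.* b'' ℤ.+ a'' ℤ.* b'))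
    re = solve-∀
    im : ∀ (k a b a' b' a'' b'' : ℤ) →
      (a ℤ.* a' ℤ.- k ℤ.* (b ℤ.* b')) ℤ.* b'' ℤ.+ a'' ℤ.* (a ℤ.* b' ℤ.+ a' ℤ.* b)
        ≡ a ℤ.* (a' ℤ.* b'' ℤ.+ a'' ℤ.* b') ℤ.+ (a' ℤ.* a'' ℤ.- k ℤ.* (b' ℤ.* b'')) ℤ.* b
    im = solve-∀

  mulC-distribʳ-subC : ∀ x y z → mulC c (subC x y) z ≡ subC (mulC c x z) (mulC c y z)
  mulC-distribʳ-subC (a , b) (a' , b') (a'' , b'') =
    cong₂ _,_ (re (+ c) a b a' b' a'' b'') (im a b a' b' a'' b'')
    where
    re : ∀ (k a b a' b' a'' b'' : ℤ) →
      (a ℤ.- a') ℤ.* a'' ℤ.- k ℤ.* ((b ℤ.- b') ℤ.* b'')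
        ≡ (a ℤ.* a'' ℤ.- k ℤ.* (b ℤ.* b'')) ℤ.- (a' ℤ.* a'' ℤ.- k ℤ.* (b' ℤ.* b''))
    re = solve-∀
    im : ∀ (a b a' b' a'' b'' : ℤ) →
      (a ℤ.- a') ℤ.* b'' ℤ.+ a'' ℤ.* (b ℤ.- b')
        ≡ (a ℤ.* b'' ℤ.+ a'' ℤ.* b) ℤ.- (a' ℤ.* b'' ℤ.+ a'' ℤ.* b')
    im = solve-∀

  normC-mulC : ∀ x y → normC (mulC c x y) ≡ normC x ℤ.* normC y
  normC-mulC (a , b) (a' , b') = brahmagupta (+ c) a b a' b'
    where
    brahmagupta : ∀ (k a b a' b' : ℤ) →
      (a ℤ.* a' ℤ.- k ℤ.* (b ℤ.* b')) ℤ.* (a ℤ.* a' ℤ.- k ℤ.* (b ℤ.* b'))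
        ℤ.+ k ℤ.* ((a ℤ.* b' ℤ.+ a' ℤ.* b) ℤ.* (a ℤ.* b' ℤ.+ a' ℤ.* b))
        ≡ (a ℤ.* a ℤ.+ k ℤ.* (b ℤ.* b)) ℤ.* (a' ℤ.* a' ℤ.+ k ℤ.* (b' ℤ.* b'))
    brahmagupta = solve-∀

  normC-oneC : normC oneC ≡ + 1
  normC-oneC = identity (+ c)
    where
    identity : ∀ (k : ℤ) → + 1 ℤ.* + 1 ℤ.+ k ℤ.* (+ 0 ℤ.* + 0) ≡ + 1
    identity = solve-∀

  _∣ᶜ_ : ℤ√- → ℤ√- → Set
  p ∣ᶜ z = Σ ℤ√- λ w → mulC c w p ≡ z

  ∣ᶜ-subC : ∀ {p y z} → p ∣ᶜ y → p ∣ᶜ z → p ∣ᶜ subC y z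
  ∣ᶜ-subC {p} (v , refl) (w , refl) = subC v w , mulC-distribʳ-subC v w p

  ∣ᶜ-mulʳ : ∀ {p z} q → p ∣ᶜ z → mulC c p q ∣ᶜ mulC c z q
  ∣ᶜ-mulʳ {p} q (w , refl) = w , sym (mulC-assoc w p q)

  ∣ᶜ-mulˡ : ∀ {p z} q → p ∣ᶜ z → mulC c q p ∣ᶜ mulC c q z
  ∣ᶜ-mulˡ {p} {z} q p∣z = subst₂ _∣ᶜ_ (mulC-comm p q) (mulC-comm z q) (∣ᶜ-mulʳ q p∣z)

  rational-multiple-components : ∀ {u v A B T} → mulC c (u , v) (A , B) ≡ (T , + 0) →
    T ℤ.* A ≡ u ℤ.* normC (A , B) × T ℤ.* B ≡ - v ℤ.* normC (A , B)
  rational-multiple-components {u} {v} {A} {B} {T} eq =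
    (begin
      T ℤ.* A                                        ≡⟨ cong (ℤ._* A) (sym re) ⟩
      (u ℤ.* A ℤ.- K ℤ.* (v ℤ.* B)) ℤ.* A            ≡⟨ onA K u v A B ⟩
      u ℤ.* N ℤ.+ - (K ℤ.* B) ℤ.* (u ℤ.* B ℤ.+ A ℤ.* v) ≡⟨ cong (λ t → u ℤ.* N ℤ.+ - (K ℤ.* B) ℤ.* t) im ⟩
      u ℤ.* N ℤ.+ - (K ℤ.* B) ℤ.* + 0                ≡⟨ dropZero (u ℤ.* N) (- (K ℤ.* B)) ⟩
      u ℤ.* N                                        ∎) ,
    (begin
      T ℤ.* B                                        ≡⟨ cong (ℤ._* B) (sym re) ⟩
      (u ℤ.* A ℤ.- K ℤ.* (v ℤ.* B)) ℤ.* B            ≡⟨ onB K u v A B ⟩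
      - v ℤ.* N ℤ.+ A ℤ.* (u ℤ.* B ℤ.+ A ℤ.* v)      ≡⟨ cong (λ t → - v ℤ.* N ℤ.+ A ℤ.* t) im ⟩
      - v ℤ.* N ℤ.+ A ℤ.* + 0                        ≡⟨ dropZero (- v ℤ.* N) A ⟩
      - v ℤ.* N                                      ∎)
    where
    open ≡-Reasoning
    K = + c
    N = normC (A , B)
    re = cong proj₁ eq
    im = cong proj₂ eq
    onA : ∀ (k u v A B : ℤ) → (u ℤ.* A ℤ.- k ℤ.* (v ℤ.* B)) ℤ.* A
      ≡ u ℤ.* (A ℤ.* A ℤ.+ k ℤ.* (B ℤ.* B)) ℤ.+ - (k ℤ.* B) ℤ.* (u ℤ.* B ℤ.+ A ℤ.* v)
    onA = solve-∀
    onB : ∀ (k u v A B : ℤ) → (u ℤ.* A ℤ.- k ℤ.* (v ℤ.* B)) ℤ.* B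
      ≡ - v ℤ.* (A ℤ.* A ℤ.+ k ℤ.* (B ℤ.* B)) ℤ.+ A ℤ.* (u ℤ.* B ℤ.+ A ℤ.* v)
    onB = solve-∀
    dropZero : ∀ (x y : ℤ) → x ℤ.+ y ℤ.* + 0 ≡ x
    dropZero = solve-∀

  hC∣∣normC∣ : ∀ p → hC p ∣ ∣ normC p ∣
  hC∣∣normC∣ (A , B) = ℤ∣.∣⇒∣ᵤ
    (ℤ∣.∣m∣n⇒∣m+n (ℤ∣.∣m⇒∣m*n A h∣A) (ℤ∣.∣n⇒∣m*n (+ c) (ℤ∣.∣m⇒∣m*n B h∣B)))
    where
    h∣A : + hC (A , B) ℤ∣.∣ A
    h∣A = ℤ∣.∣ᵤ⇒∣ (gcd[m,n]∣m ∣ A ∣ ∣ B ∣)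
    h∣B : + hC (A , B) ℤ∣.∣ B
    h∣B = ℤ∣.∣ᵤ⇒∣ (gcd[m,n]∣n ∣ A ∣ ∣ B ∣)

  ∣ᶜ-rational⇒∣normC∣∣ : ∀ {p T} → p ∣ᶜ (+ T , + 0) → ∣ normC p ∣ ∣ T * hC p
  ∣ᶜ-rational⇒∣normC∣∣ {A , B} {T} ((u , v) , eq) =
    subst (∣ normC (A , B) ∣ ∣_) (sym (c*gcd[m,n]≡gcd[cm,cn] T ∣ A ∣ ∣ B ∣))
      (gcd-greatest (unsigned u (proj₁ components)) (unsigned (- v) (proj₂ components)))
    where
    components = rational-multiple-components {u} {v} {A} {B} eq
    unsigned : ∀ {X} w → + T ℤ.* X ≡ w ℤ.* normC (A , B) → ∣ normC (A , B) ∣ ∣ T * ∣ X ∣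
    unsigned {X} w TX≡wN = subst (_ ∣_) (ℤₚ.abs-* (+ T) X) (ℤ∣.∣⇒∣ᵤ (ℤ∣.divides w TX≡wN))

  ∣ᶜ-rational⇒quotient∣ : ∀ {p T N} → p ∣ᶜ (+ T , + 0) → normC p ≡ + N → .{{NonZero N}} →
    Σ ℕ λ q → q * hC p ≡ N × q ∣ T
  ∣ᶜ-rational⇒quotient∣ {p} {T} {N} p∣T normC≡N =
    N / hC p , m/n*n≡m h∣N , ℕ∣.m∣n*o⇒m/n∣o h∣N N∣T*h
    where
    h∣N : hC p ∣ N
    h∣N = subst (hC p ∣_) (cong ∣_∣ normC≡N) (hC∣∣normC∣ p)
    N∣T*h : N ∣ T * hC p
    N∣T*h = subst (_∣ T * hC p) (cong ∣_∣ normC≡N) (∣ᶜ-rational⇒∣normC∣∣ p∣T)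
    instance
      hC≢0 : NonZero (hC p)
      hC≢0 = ℕ.≢-nonZero λ h≡0 → ℕ.≢-nonZero⁻¹ N (ℕ∣.0∣⇒≡0 (subst (_∣ N) h≡0 h∣N))

  rootProd : List ℕ → ℤ√-
  rootProd = foldr (λ k acc → mulC c (+ k , + 1) acc) oneC

  normProd : List ℕ → ℕ
  normProd = foldr (λ k acc → (k * k + c) * acc) 1

  normLcm : List ℕ → ℕ
  normLcm = foldr (λ k acc → lcm (k * k + c) acc) 1

  pos-factor : ∀ k → + (k * k + c) ≡ + k ℤ.* + k ℤ.+ + c
  pos-factor k = trans (ℤₚ.pos-+ (k * k) c) (cong (ℤ._+ + c) (ℤₚ.pos-* k k))

  normC-rootProd : ∀ l → normC (rootProd l) ≡ + normProd l
  normC-rootProd []      = normC-oneC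
  normC-rootProd (k ∷ l) = begin
    normC (mulC c (+ k , + 1) (rootProd l))      ≡⟨ normC-mulC (+ k , + 1) (rootProd l) ⟩
    normC (+ k , + 1) ℤ.* normC (rootProd l)     ≡⟨ cong₂ ℤ._*_ normC-root (normC-rootProd l) ⟩
    + (k * k + c) ℤ.* + normProd l               ≡⟨ sym (ℤₚ.pos-* (k * k + c) (normProd l)) ⟩
    + normProd (k ∷ l)                           ∎
    where
    open ≡-Reasoning
    normC-root : normC (+ k , + 1) ≡ + (k * k + c)
    normC-root = trans (cong (λ t → + k ℤ.* + k ℤ.+ t) (ℤₚ.*-identityʳ (+ c))) (sym (pos-factor k))

  normProd≢0 : .{{NonZero c}} → ∀ l → NonZero (normProd l)
  normProd≢0 []      = _
  normProd≢0 (k ∷ l) = ℕₚ.m*n≢0 (k * k + c) (normProd l) {{factor≢0}} {{normProd≢0 l}}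
    where
    factor≢0 : NonZero (k * k + c)
    factor≢0 = ℕ.>-nonZero (ℕₚ.<-≤-trans (ℕ.>-nonZero⁻¹ c) (ℕₚ.m≤n+m c (k * k)))

  ∣normLcm : ∀ l → All (λ k → k * k + c ∣ normLcm l) l
  ∣normLcm []      = []
  ∣normLcm (k ∷ l) = m∣lcm[m,n] (k * k + c) (normLcm l)
    ∷ All.map (λ d → ℕ∣.∣-trans d (n∣lcm[m,n] (k * k + c) (normLcm l))) (∣normLcm l)

  rootProd-∷ʳ : ∀ l y → rootProd (l ∷ʳ y) ≡ mulC c (rootProd l) (+ y , + 1)
  rootProd-∷ʳ []      y = mulC-comm (+ y , + 1) oneC
  rootProd-∷ʳ (k ∷ l) y = trans (cong (mulC c (+ k , + 1)) (rootProd-∷ʳ l y))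
    (sym (mulC-assoc (+ k , + 1) (rootProd l) (+ y , + 1)))

  rootProd-singleton-∣ᶜ : ∀ x M → x * x + c ∣ M → rootProd (x ∷ []) ∣ᶜ (+ M , + 0)
  rootProd-singleton-∣ᶜ x M (ℕ∣.divides a M≡a*f) =
    -- the cofactor is a (x − √-c)
    (+ a ℤ.* + x , - + a) , (begin
      mulC c (+ a ℤ.* + x , - + a) (mulC c (+ x , + 1) oneC) ≡⟨ cofactor (+ a) (+ x) ⟩
      (+ a ℤ.* (+ x ℤ.* + x ℤ.+ + c) , + 0)                  ≡⟨ cong (_, + 0) (sym M≡) ⟩
      (+ M , + 0)                                            ∎)
    where
    open ≡-Reasoning
    cofactor : ∀ (a x : ℤ) →
      mulC c (a ℤ.* x , - a) (mulC c (x , + 1) oneC) ≡ (a ℤ.* (x ℤ.* x ℤ.+ + c) , + 0)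
    cofactor a x = cong₂ _,_ (re (+ c) a x) (im (+ c) a x)
      where
      re : ∀ (k a x : ℤ) → (a ℤ.* x) ℤ.* (x ℤ.* + 1 ℤ.- k ℤ.* (+ 1 ℤ.* + 0))
          ℤ.- k ℤ.* ((- a) ℤ.* (x ℤ.* + 0 ℤ.+ + 1 ℤ.* + 1)) ≡ a ℤ.* (x ℤ.* x ℤ.+ k)
      re = solve-∀
      im : ∀ (k a x : ℤ) → (a ℤ.* x) ℤ.* (x ℤ.* + 0 ℤ.+ + 1 ℤ.* + 1)
          ℤ.+ (x ℤ.* + 1 ℤ.- k ℤ.* (+ 1 ℤ.* + 0)) ℤ.* (- a) ≡ + 0
      im = solve-∀
    M≡ : + M ≡ + a ℤ.* (+ x ℤ.* + x ℤ.+ + c)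
    M≡ = begin
      + M                           ≡⟨ cong +_ M≡a*f ⟩
      + (a * (x * x + c))           ≡⟨ ℤₚ.pos-* a (x * x + c) ⟩
      + a ℤ.* + (x * x + c)         ≡⟨ cong (+ a ℤ.*_) (pos-factor x) ⟩
      + a ℤ.* (+ x ℤ.* + x ℤ.+ + c) ∎

  subC-telescope : ∀ t x s →
    subC (mulC c (t , + 0) (x ℤ.+ s , + 1)) (mulC c (x , + 1) (t , + 0)) ≡ (t ℤ.* s , + 0)
  subC-telescope t x s = cong₂ _,_ (re (+ c) t x s) (im t x s)
    where
    re : ∀ (k t x s : ℤ) → (t ℤ.* (x ℤ.+ s) ℤ.- k ℤ.* (+ 0 ℤ.* + 1))
        ℤ.- (x ℤ.* t ℤ.- k ℤ.* (+ 1 ℤ.* + 0)) ≡ t ℤ.* s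
    re = solve-∀
    im : ∀ (t x s : ℤ) → (t ℤ.* + 1 ℤ.+ (x ℤ.+ s) ℤ.* + 0)
        ℤ.- (x ℤ.* + 0 ℤ.+ t ℤ.* + 1) ≡ + 0
    im = solve-∀

  rootProd-interval-∣ᶜ : ∀ x N M → All (λ k → k * k + c ∣ M) (interval x N) →
    rootProd (interval x N) ∣ᶜ (+ (M * N !) , + 0)
  rootProd-interval-∣ᶜ x zero M (f∣M ∷ []) =
    subst (λ t → rootProd (x ∷ []) ∣ᶜ (+ t , + 0)) (sym (ℕₚ.*-identityʳ M))
      (rootProd-singleton-∣ᶜ x M f∣M)
  rootProd-interval-∣ᶜ x (suc N) M f∣M@(_ ∷ f∣M⁺) =
    subst (rootProd (interval x (suc N)) ∣ᶜ_) difference (∣ᶜ-subC viaLast viaFirst)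
    where
    open ≡-Reasoning
    y = x + suc N
    T = (+ (M * N !) , + 0)
    f∣M⁻ : All (λ k → k * k + c ∣ M) (interval x N)
    f∣M⁻ = proj₁ (∷ʳ⁻ (subst (All _) (interval-∷ʳ x N) f∣M))
    viaLast : rootProd (interval x (suc N)) ∣ᶜ mulC c T (+ y , + 1)
    viaLast = subst (_∣ᶜ mulC c T (+ y , + 1))
      (sym (trans (cong rootProd (interval-∷ʳ x N)) (rootProd-∷ʳ (interval x N) y)))
      (∣ᶜ-mulʳ (+ y , + 1) (rootProd-interval-∣ᶜ x N M f∣M⁻))
    viaFirst : rootProd (interval x (suc N)) ∣ᶜ mulC c (+ x , + 1) T
    viaFirst = ∣ᶜ-mulˡ (+ x , + 1) (rootProd-interval-∣ᶜ (suc x) N M f∣M⁺)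
    difference : subC (mulC c T (+ y , + 1)) (mulC c (+ x , + 1) T) ≡ (+ (M * suc N !) , + 0)
    difference = begin
      subC (mulC c T (+ y , + 1)) (mulC c (+ x , + 1) T)
        ≡⟨ cong (λ t → subC (mulC c T (t , + 1)) (mulC c (+ x , + 1) T)) (ℤₚ.pos-+ x (suc N)) ⟩
      subC (mulC c T (+ x ℤ.+ + suc N , + 1)) (mulC c (+ x , + 1) T)
        ≡⟨ subC-telescope (+ (M * N !)) (+ x) (+ suc N) ⟩
      (+ (M * N !) ℤ.* + suc N , + 0)
        ≡⟨ cong (_, + 0) (sym (ℤₚ.pos-* (M * N !) (suc N))) ⟩
      (+ (M * N ! * suc N) , + 0)
        ≡⟨ cong (λ t → + t , + 0) (trans (ℕₚ.*-assoc M (N !) (suc N)) (cong (M *_) (ℕₚ.*-comm (N !) (suc N)))) ⟩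
      (+ (M * suc N !) , + 0) ∎

  rootProd-range-∣ᶜ : ∀ m n M → All (λ k → k * k + c ∣ M) (range m n) →
    rootProd (range m n) ∣ᶜ (+ (M * (n ∸ m) !) , + 0)
  rootProd-range-∣ᶜ m n M f∣M = subst (λ l → rootProd l ∣ᶜ (+ (M * (n ∸ m) !) , + 0)) (sym range≡)
    (rootProd-interval-∣ᶜ m (n ∸ m) M (subst (All (λ k → k * k + c ∣ M)) range≡ f∣M))
    where range≡ = range≡interval m n

mainTheorem13 : (c m n : ℕ) → .{{_ : NonZero c}} → .{{_ : NonZero m}} → m ≤ n →
    Σ ℕ (λ q → (q * hC (prodRoot c m n) ≡ prodNorm c m n)
    × (q ∣ Lcmn c m n * (n ∸ m) !))
mainTheorem13 c m n _ =
  ∣ᶜ-rational⇒quotient∣ c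
    (rootProd-range-∣ᶜ c m n (normLcm c (range m n)) (∣normLcm c (range m n)))
    (normC-rootProd c (range m n))
    {{normProd≢0 c (range m n)}}
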